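{- Let $\mathbf{C}$ and $\mathbf{D}$ be categories such that $\mathbf{C}$ has the canonical Ramsey property. If there exists a canonical pre-adjunction $F:\mathrm{Ob}(\mathbf{D})\rightleftarrows\mathrm{Ob}(\mathbf{C}):G$ between $\mathbf{C}$ and $\mathbf{D}$, then $\mathbf{D}$ has the canonical Ramsey property.
   Context: A pair of maps $F:\mathrm{Ob}(\mathbf{D})\to\mathrm{Ob}(\mathbf{C})$, $G:\mathrm{Ob}(\mathbf{C})\to\mathrm{Ob}(\mathbf{D})$ is a canonical pre-adjunction between $\mathbf{C}$ and $\mathbf{D}$ if there are families of maps $\Phi_{Y,X}:\hom_{\mathbf{C}}(F(Y),X)\to\hom_{\mathbf{D}}(Y,G(X))$ and $F_{Y,X}:\hom_{\mathbf{D}}(Y,X)\to\hom_{\mathbf{C}}(F(Y),F(X))$ (written simply $F(f)$) such that: (CPA1) for all $C\in\mathrm{Ob}(\mathbf{C})$, $D,E\in\mathrm{Ob}(\mathbf{D})$, $u\in\hom_{\mathbf{C}}(F(D),C)$ and $f\in\hom_{\mathbf{D}}(E,D)$: $\Phi_{D,C}(u)\cdot f=\Phi_{E,C}(u\cdot F(f))$; (CPA2) for all $D,E\in\mathrm{Ob}(\mathbf{D})$, $Q\in\mathrm{Ob}(\mathbf{C})$ and $q\in\hom_{\mathbf{C}}(Q,F(E))$ there exist $Q'\in\mathrm{Ob}(\mathbf{D})$ and $q'\in\hom_{\mathbf{D}}(Q',E)$ such that for all $f,g\in\hom_{\mathbf{D}}(E,D)$: $F(f)\cdot q=F(g)\cdot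 q$ iff $f\cdot q'=g\cdot q'$. ($F,G$ need not be functors.) For objects $A,B,C$ of a category, $C\xrightarrow{can}(B)^A$ means: for every $\chi:\hom(A,C)\to\omega$ there exist $w\in\hom(B,C)$, an object $Q$ and $q\in\hom(Q,A)$ such that for all $f,g\in\hom(A,B)$, $\chi(w\cdot f)=\chi(w\cdot g)$ iff $f\cdot q=g\cdot q$. A category has the canonical Ramsey property if for all objects $A,B$ with $\hom(A,B)\neq\varnothing$ there is an object $C$ with $C\xrightarrow{can}(B)^A$. -}

module Defs where

open import Level using (Level; _⊔_; suc)
open import Data.Nat using (ℕ)
open import Data.Product using (Σ; Σ-syntax; _×_)
open import Relation.Nullary using (¬_)
open import Relation.Binary.PropositionalEquality using (_≡_)
open import Function.Bundles using (_⇔_)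

-- A (locally small) category: hom-types with propositional equality of morphisms.
-- Composition is written  g ∘ f  for  g · f  (first f, then g).
record Category (o h : Level) : Set (Level.suc (o ⊔ h)) where
  infixr 9 _∘_
  field
    Ob    : Set o
    Hom   : Ob → Ob → Set h
    id    : ∀ {A} → Hom A A
    _∘_   : ∀ {A B C} → Hom B C → Hom A B → Hom A C
    assoc : ∀ {A B C D} (f : Hom A B) (g : Hom B C) (k : Hom C D) →
            (k ∘ g) ∘ f ≡ k ∘ (g ∘ f)
    identityˡ : ∀ {A B} (f : Hom A B) → id ∘ f ≡ f
    identityʳ : ∀ {A B} (f : Hom A B) → f ∘ id ≡ f

module _ {o h : Level} (𝐂 : Category o h) where
  open Category 𝐂

  CanArrow : Ob → Ob → Ob → Set (o ⊔ h)
  CanArrow C B A =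
    (χ : Hom A C → ℕ) →
    Σ[ w ∈ Hom B C ] Σ[ Q ∈ Ob ] Σ[ q ∈ Hom Q A ]
      ((f g : Hom A B) → (χ (w ∘ f) ≡ χ (w ∘ g)) ⇔ (f ∘ q ≡ g ∘ q))

  -- canonical Ramsey property; "hom(A,B) ≠ ∅" read literally as ¬ (hom(A,B) is empty)
  CanonicalRamsey : Set (o ⊔ h)
  CanonicalRamsey =
    (A B : Ob) → ¬ ¬ Hom A B → Σ[ C ∈ Ob ] CanArrow C B A

record CanonicalPreAdjunction {o₁ h₁ o₂ h₂ : Level}
    (𝐂 : Category o₁ h₁) (𝐃 : Category o₂ h₂) : Set (o₁ ⊔ h₁ ⊔ o₂ ⊔ h₂) where
  private
    module C = Category 𝐂
    module D = Category 𝐃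
  field
    F   : D.Ob → C.Ob
    G   : C.Ob → D.Ob
    Φ   : ∀ {Y X} → C.Hom (F Y) X → D.Hom Y (G X)
    Fₕ  : ∀ {Y X} → D.Hom Y X → C.Hom (F Y) (F X)
    CPA1 : ∀ {C' D' E} (u : C.Hom (F D') C') (f : D.Hom E D') →
           Φ u D.∘ f ≡ Φ (u C.∘ Fₕ f)
    CPA2 : ∀ (D' E : D.Ob) (Q : C.Ob) (q : C.Hom Q (F E)) →
           Σ[ Q' ∈ D.Ob ] Σ[ q' ∈ D.Hom Q' E ]
             ((f g : D.Hom E D') → (Fₕ f C.∘ q ≡ Fₕ g C.∘ q) ⇔ (f D.∘ q' ≡ g D.∘ q'))

module Submission where

-- Given objects A, B of 𝐃 with hom(A,B) nonempty, hom(F A, F B) is nonempty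
-- too, so the canonical Ramsey property of 𝐂 yields C with
-- C →can (F B)^(F A).  We show G C →can (B)^A.  A colouring χ of hom(A, G C)
-- pulls back along Φ to the colouring u ↦ χ (Φ u) of hom(F A, C); for it 𝐂
-- provides w, Q, q.  We take Φ w as the witness in 𝐃, and q' : Q' → A from
-- (CPA2) applied to q.  For f, g : A → B the required equivalence is the chain
--   χ(Φ w · f) = χ(Φ w · g)
--   ⇔ χ(Φ(w · F f)) = χ(Φ(w · F g))     by (CPA1)
--   ⇔ F f · q = F g · q                  by the choice of w, Q, q
--   ⇔ f · q' = g · q'                    by (CPA2).

open import Defs
open import Level using (Level)
open import Data.Nat using (ℕ)
open import Data.Product using (_,_)
open import Function.Base using (id)
open import Function.Bundles using (_⇔_; mk⇔)
open import Function.Construct.Composition using (_⇔-∘_)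
open import Relation.Nullary using (¬_)
open import Relation.Binary.PropositionalEquality using (_≡_; refl; cong)

≡-cong-⇔ : ∀ {a} {X : Set a} {x x' y y' : X} →
           x ≡ x' → y ≡ y' → (x ≡ y) ⇔ (x' ≡ y')
≡-cong-⇔ refl refl = mk⇔ id id

module Transfer {o₁ h₁ o₂ h₂ : Level} {𝐂 : Category o₁ h₁} {𝐃 : Category o₂ h₂}
                (P : CanonicalPreAdjunction 𝐂 𝐃) where
  open CanonicalPreAdjunction P
  private
    module C = Category 𝐂
    module D = Category 𝐃

  F-preserves-nonempty : ∀ {A B} → ¬ ¬ D.Hom A B → ¬ ¬ C.Hom (F A) (F B)
  F-preserves-nonempty nonempty noMorphism = nonempty (λ f → noMorphism (Fₕ f))

  pullbackColouring : ∀ {A C'} → (D.Hom A (G C') → ℕ) → C.Hom (F A) C' → ℕ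
  pullbackColouring χ u = χ (Φ u)

  colour-of-composite : ∀ {A B C'} (χ : D.Hom A (G C') → ℕ)
                        (w : C.Hom (F B) C') (f : D.Hom A B) →
                        χ (Φ w D.∘ f) ≡ pullbackColouring χ (w C.∘ Fₕ f)
  colour-of-composite χ w f = cong χ (CPA1 w f)

  transfer-arrow : ∀ {A B C'} → CanArrow 𝐂 C' (F B) (F A) → CanArrow 𝐃 (G C') B A
  transfer-arrow {A} {B} arrow χ with arrow (pullbackColouring χ)
  ... | w , Q , q , canonical with CPA2 B A Q q
  ... | Q' , q' , reflects = Φ w , Q' , q' , λ f g →
    reflects f g ⇔-∘ (canonical (Fₕ f) (Fₕ g) ⇔-∘
      ≡-cong-⇔ (colour-of-composite χ w f) (colour-of-composite χ w g))

theorem5p2 : {o₁ h₁ o₂ h₂ : Level} (𝐂 : Category o₁ h₁) (𝐃 : Category o₂ h₂) →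
    CanonicalRamsey 𝐂 → CanonicalPreAdjunction 𝐂 𝐃 → CanonicalRamsey 𝐃
theorem5p2 𝐂 𝐃 ramsey P A B nonempty =
  let C , arrow = ramsey (F A) (F B) (F-preserves-nonempty nonempty)
  in  G C , transfer-arrow arrow
  where
  open CanonicalPreAdjunction P using (F; G)
  open Transfer P
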